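{- Let $v_1,\dots,v_k\in\mathbb{Z}_{\ge0}^2$, none lying on a coordinate axis, be such that $\mathcal U=U((1,0),(0,1),v_1,\dots,v_k)$ is non-degenerate. Then there exists $v=(w_1,w_2)\in\mathbb{Z}_{\ge0}^2$ such that every $(m,n)\in\mathcal U$ with $m\ge w_1$ and $n\ge w_2$ satisfies $m\equiv w_1\pmod 2$ and $n\equiv w_2\pmod 2$.
   Context: Fix a norm on $\mathbb{Z}^2$ increasing monotonically in each coordinate. For vectors $u_1,\dots,u_r\in\mathbb{Z}_{\ge0}^2$, the Ulam set $U(u_1,\dots,u_r)$ is built recursively: it starts with $u_1,\dots,u_r$, and at each step one adds a vector not yet in the set, of smallest norm among those that can be written as a sum of two distinct vectors of the current set in exactly one way (the resulting set is known not to depend on the choice of such norm or on tie-breaking). $U(u_1,\dots,u_r)$ is non-degenerate if $u_i\notin U(u_1,\dots,u_{i-1},u_{i+1},\dots,u_r)$ for each $i$. -}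

module Defs where

open import Data.Nat using (ℕ; zero; suc; _+_; _∸_; _≡ᵇ_)
open import Data.Bool using (Bool; true; false; _∧_; _∨_; if_then_else_)
open import Data.Product using (_×_; _,_; proj₁; proj₂)
open import Data.List using (List; []; _∷_; upTo; map; length; removeAt; lookup)
open import Data.Nat.ListAction using (sum)
open import Data.Bool.ListAction using (any)
open import Data.Fin using (Fin)
open import Relation.Binary.PropositionalEquality using (_≡_)
open import Relation.Nullary using (¬_)

Vec2 : Set
Vec2 = ℕ × ℕ

_==_ : Vec2 → Vec2 → Bool
(a , b) == (c , d) = (a ≡ᵇ c) ∧ (b ≡ᵇ d)

-- Ulam set construction with the ℓ¹ norm ‖(m,n)‖ = m + n (monotone in each
-- coordinate).  With all generators nonzero, every element of the set is
-- nonzero, so a vector of norm N can only be written as a + b with a, b of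
-- norm < N; the greedy process therefore decides all vectors norm by norm:
-- (m,n) ∈ U  iff  (m,n) is a generator, or (m,n) = a + b for exactly one
-- unordered pair {a,b} of distinct elements of U.
-- memF s us m n decides membership using fuel s (s > m + n suffices).
-- The number of ordered pairs (a,b), a ≠ b, a + b = (m,n), a,b ∈ U is counted;
-- "exactly one unordered representation" means this count equals 2.
memF : ℕ → List Vec2 → ℕ → ℕ → Bool
memF zero    us m n = false
memF (suc s) us m n =
  any (λ u → u == (m , n)) us ∨
  (sum (map (λ i → sum (map (λ j →
      if ((i , j) == (m ∸ i , n ∸ j))
      then 0
      else (if memF s us i j ∧ memF s us (m ∸ i) (n ∸ j) then 1 else 0))
    (upTo (suc n)))) (upTo (suc m))) ≡ᵇ 2)

_∈U_ : Vec2 → List Vec2 → Set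
(m , n) ∈U us = memF (suc (m + n)) us m n ≡ true

NonDegenerate : List Vec2 → Set
NonDegenerate us = (i : Fin (length us)) → ¬ (lookup us i ∈U removeAt us i)

{-# OPTIONS --safe #-}
module Submission where

-- Write e₁ = (1,0), e₂ = (0,1) and let every generator lie in [0,P]².  Since the other generators
-- avoid the axes, U meets the axes only in e₁ and e₂, and contains the whole row y = 1 and the
-- whole column x = 1.  Hence an element (c,n) with c, n ≥ 2 excludes every non-generator (m,n+1)
-- with m ≥ c, which then has the three representations (1,n)+(m-1,1), (m-1,1)+(1,n) and
-- (c,n)+(m-c,1); symmetrically for columns.  Call a column tall if it has an element of height in
-- [2,P].  Right of x = P the heights of tall columns strictly decrease, so some column j ≥ 2 is not
-- tall; for the first such j, column j is {(j,1)} and the columns strictly between 1 and j stay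
-- below height P + 1.  For n ≥ 2P the representations of (j+1,n+1) are then (1,n)+(j,1) in both
-- orders, together with (0,1)+(j+1,n) in both orders exactly when (j+1,n) ∈ U, so column j+1
-- alternates above height 2P.  Fixing (j+1,n₁) ∈ U there, the exclusion above shows that every
-- element of U right of j+1 and above n₁ has the parity of n₁ as its height; columns are symmetric.

open import Defs
open import Data.Nat using (ℕ; _≤_; _%_)
open import Data.Product using (_×_; _,_; ∃₂)
open import Data.List using (List; _∷_)
open import Data.List.Relation.Unary.All using (All)
open import Relation.Binary.PropositionalEquality using (_≡_; _≢_)

open import Algebra.Properties.CommutativeSemigroup using (interchange)
open import Data.Bool using (Bool; true; false; _∧_; _∨_; if_then_else_; T)
import Data.Bool as Bool
open import Data.Bool.ListAction using (any)
open import Data.Bool.Properties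
  using (∧-comm; ∧-zeroʳ; ∧-conicalˡ; ∧-conicalʳ; ∨-identityʳ; ∨-zeroʳ; ¬-not)
open import Data.List using ([]; length; map; upTo; applyUpTo)
open import Data.List.Membership.Propositional using (_∈_)
open import Data.List.Membership.Propositional.Properties using (∈-map⁺; ∈-map⁻)
open import Data.List.Properties using (map-cong-local)
import Data.List.Relation.Unary.All as All
open import Data.List.Relation.Unary.All using ([]; _∷_)
open import Data.List.Relation.Unary.AllPairs using ([]; _∷_)
open import Data.List.Relation.Unary.Any using (here; there)
open import Data.List.Relation.Unary.Unique.Propositional using (Unique)
open import Data.Nat using (zero; suc; _+_; _∸_; _*_; _≡ᵇ_; _<_; z≤n; s≤s; z<s; _≟_; _≤?_; _<?_)
open import Data.Nat.DivMod using ([m+kn]%n≡m%n)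
open import Data.Nat.Induction using (<-rec)
open import Data.Nat.ListAction using (sum)
open import Data.Nat.Properties
open import Data.Product using (proj₁; proj₂; ∃; uncurry; swap)
open import Data.Product.Properties using (,-injective; ,-injectiveˡ; ,-injectiveʳ)
open import Data.Sum using (_⊎_; inj₁; inj₂)
open import Data.Unit using (tt)
open import Function using (_∘_; id)
open import Relation.Binary.Definitions using (DecidableEquality)
open import Relation.Binary.PropositionalEquality
  using (refl; sym; trans; cong; cong₂; subst; ≢-sym; module ≡-Reasoning)
open import Relation.Nullary using (¬_; yes; no; contradiction)
open import Relation.Nullary.Decidable using (map′; _×-dec_; dec-true; dec-false)
open import Relation.Unary using (Decidable)

-- Finite sums and vectors

∑ : ℕ → (ℕ → ℕ) → ℕ
∑ zero    f = 0
∑ (suc k) f = f 0 + ∑ k (f ∘ suc)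

sum-map-applyUpTo : ∀ (f g : ℕ → ℕ) k → sum (map f (applyUpTo g k)) ≡ ∑ k (f ∘ g)
sum-map-applyUpTo f g zero    = refl
sum-map-applyUpTo f g (suc k) = cong (f (g 0) +_) (sum-map-applyUpTo f (g ∘ suc) k)

∑-cong : ∀ k {f g : ℕ → ℕ} → (∀ {i} → i < k → f i ≡ g i) → ∑ k f ≡ ∑ k g
∑-cong zero    f≡g = refl
∑-cong (suc k) f≡g = cong₂ _+_ (f≡g (s≤s z≤n)) (∑-cong k (f≡g ∘ s≤s))

∑-zero : ∀ k → ∑ k (λ _ → 0) ≡ 0
∑-zero zero    = refl
∑-zero (suc k) = ∑-zero k

∑-distrib-+ : ∀ k (f g : ℕ → ℕ) → ∑ k (λ i → f i + g i) ≡ ∑ k f + ∑ k g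
∑-distrib-+ zero    f g = refl
∑-distrib-+ (suc k) f g = trans (cong (f 0 + g 0 +_) (∑-distrib-+ k (f ∘ suc) (g ∘ suc)))
                                (interchange +-commutativeSemigroup (f 0) (g 0) _ _)

∑-comm : ∀ a b (f : ℕ → ℕ → ℕ) → ∑ a (λ i → ∑ b (f i)) ≡ ∑ b (λ j → ∑ a (λ i → f i j))
∑-comm zero    b f = sym (∑-zero b)
∑-comm (suc a) b f = trans (cong (∑ b (f 0) +_) (∑-comm a b (f ∘ suc)))
                           (sym (∑-distrib-+ b (f 0) (λ j → ∑ a (λ i → f (suc i) j))))

∑-indicator : ∀ {k a} c → a < k → ∑ k (λ i → if i ≡ᵇ a then c else 0) ≡ c
∑-indicator {suc k} {zero}  c _         = trans (cong (c +_) (∑-zero k)) (+-identityʳ c)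
∑-indicator {suc k} {suc a} c (s≤s a<k) = ∑-indicator c a<k

infixl 6 _+ᵥ_ _∸ᵥ_
infix 4 _≤ᵥ_

_+ᵥ_ : Vec2 → Vec2 → Vec2
(a , b) +ᵥ (c , d) = a + c , b + d

_∸ᵥ_ : Vec2 → Vec2 → Vec2
(a , b) ∸ᵥ (c , d) = a ∸ c , b ∸ d

_≤ᵥ_ : Vec2 → Vec2 → Set
(a , b) ≤ᵥ (c , d) = a ≤ c × b ≤ d

‖_‖ : Vec2 → ℕ
‖ a , b ‖ = a + b

+ᵥ-comm : ∀ p q → p +ᵥ q ≡ q +ᵥ p
+ᵥ-comm (a , b) (c , d) = cong₂ _,_ (+-comm a c) (+-comm b d)

+ᵥ⇒≤ᵥ : ∀ {q w v} → q +ᵥ w ≡ v → q ≤ᵥ v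
+ᵥ⇒≤ᵥ {i , j} {a , b} refl = m≤m+n i a , m≤m+n j b

+ᵥ⇒∸ᵥ : ∀ {q w v} → q +ᵥ w ≡ v → v ∸ᵥ q ≡ w
+ᵥ⇒∸ᵥ {i , j} {a , b} refl = cong₂ _,_ (m+n∸m≡n i a) (m+n∸m≡n j b)

≤ᵥ⇒+ᵥ∸ᵥ : ∀ {q v} → q ≤ᵥ v → q +ᵥ (v ∸ᵥ q) ≡ v
≤ᵥ⇒+ᵥ∸ᵥ {i , j} {m , n} (i≤m , j≤n) = cong₂ _,_ (m+[n∸m]≡n i≤m) (m+[n∸m]≡n j≤n)

‖‖-zero : ∀ {w} → ‖ w ‖ ≡ 0 → w ≡ (0 , 0)
‖‖-zero {a , b} a+b≡0 = cong₂ _,_ (m+n≡0⇒m≡0 a a+b≡0) (m+n≡0⇒n≡0 a a+b≡0)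

‖‖-∸ᵥ : ∀ {q v} → q ≤ᵥ v → ‖ q ‖ + ‖ v ∸ᵥ q ‖ ≡ ‖ v ‖
‖‖-∸ᵥ {i , j} {m , n} (i≤m , j≤n) =
  trans (interchange +-commutativeSemigroup i j (m ∸ i) (n ∸ j))
        (cong₂ _+_ (m+[n∸m]≡n i≤m) (m+[n∸m]≡n j≤n))

+≡⇒< : ∀ {a b c} → a + b ≡ c → b ≢ 0 → a < c
+≡⇒< {a} a+b≡c b≢0 = subst (a <_) a+b≡c (m<m+n a (n≢0⇒n>0 b≢0))

split-‖‖ : ∀ {q v} → q ≤ᵥ v →
  q ≡ (0 , 0) ⊎ v ∸ᵥ q ≡ (0 , 0) ⊎ (‖ q ‖ < ‖ v ‖ × ‖ v ∸ᵥ q ‖ < ‖ v ‖)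
split-‖‖ {q} {v} q≤v with ‖ q ‖ ≟ 0 | ‖ v ∸ᵥ q ‖ ≟ 0
... | yes q≡0 | _         = inj₁ (‖‖-zero q≡0)
... | no  _   | yes v∸q≡0 = inj₂ (inj₁ (‖‖-zero v∸q≡0))
... | no  q≢0 | no  v∸q≢0 = inj₂ (inj₂
  ( +≡⇒< (‖‖-∸ᵥ q≤v) v∸q≢0
  , +≡⇒< (trans (+-comm ‖ v ∸ᵥ q ‖ ‖ q ‖) (‖‖-∸ᵥ q≤v)) q≢0))

≢₁ : ∀ {a b c d : ℕ} → a ≢ c → (a , b) ≢ (c , d)
≢₁ a≢c = a≢c ∘ ,-injectiveˡ

≢₂ : ∀ {a b c d : ℕ} → b ≢ d → (a , b) ≢ (c , d)
≢₂ b≢d = b≢d ∘ ,-injectiveʳ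

-- Defined so that  does (p ≟ᵥ q)  is  p == q  by computation.
_≟ᵥ_ : DecidableEquality Vec2
(a , b) ≟ᵥ (c , d) = map′ (uncurry (cong₂ _,_)) ,-injective ((a ≟ c) ×-dec (b ≟ d))

==-refl : ∀ p → (p == p) ≡ true
==-refl p = dec-true (p ≟ᵥ p) refl

==-≢ : ∀ {p q} → p ≢ q → (p == q) ≡ false
==-≢ {p} {q} = dec-false (p ≟ᵥ q)

==-swap : ∀ p q → (swap p == swap q) ≡ (p == q)
==-swap (a , b) (c , d) = ∧-comm (b ≡ᵇ d) (a ≡ᵇ c)

∑≤ : Vec2 → (Vec2 → ℕ) → ℕ
∑≤ (m , n) h = ∑ (suc m) λ i → ∑ (suc n) λ j → h (i , j)

∑≤-cong : ∀ {m n} {h g : Vec2 → ℕ} → (∀ {q} → q ≤ᵥ (m , n) → h q ≡ g q) →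
          ∑≤ (m , n) h ≡ ∑≤ (m , n) g
∑≤-cong {m} {n} h≡g =
  ∑-cong (suc m) λ i≤m → ∑-cong (suc n) λ j≤n → h≡g (≤-pred i≤m , ≤-pred j≤n)

∑≤-zero : ∀ {m n} {h : Vec2 → ℕ} → (∀ {q} → q ≤ᵥ (m , n) → h q ≡ 0) → ∑≤ (m , n) h ≡ 0
∑≤-zero {m} {n} h≡0 =
  trans (∑≤-cong {m} {n} h≡0) (trans (∑-cong (suc m) λ _ → ∑-zero (suc n)) (∑-zero (suc m)))

∑≤-distrib-+ : ∀ {m n} (h g : Vec2 → ℕ) →
               ∑≤ (m , n) (λ q → h q + g q) ≡ ∑≤ (m , n) h + ∑≤ (m , n) g
∑≤-distrib-+ {m} {n} h g =
  trans (∑-cong (suc m) λ {i} _ → ∑-distrib-+ (suc n) (λ j → h (i , j)) (λ j → g (i , j)))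
        (∑-distrib-+ (suc m) (λ i → ∑ (suc n) λ j → h (i , j)) (λ i → ∑ (suc n) λ j → g (i , j)))

∑≤-swap : ∀ {m n} (h : Vec2 → ℕ) → ∑≤ (n , m) h ≡ ∑≤ (m , n) (h ∘ swap)
∑≤-swap {m} {n} h = ∑-comm (suc n) (suc m) (λ j i → h (j , i))

∑≤-indicator : ∀ {m n a b} c → (a , b) ≤ᵥ (m , n) →
               ∑≤ (m , n) (λ q → if q == (a , b) then c else 0) ≡ c
∑≤-indicator {m} {n} {a} {b} c (a≤m , b≤n) =
  trans (∑-cong (suc m) λ {i} _ → row (i ≡ᵇ a)) (∑-indicator c (s≤s a≤m))
  where
  row : ∀ x → ∑ (suc n) (λ j → if x ∧ (j ≡ᵇ b) then c else 0) ≡ (if x then c else 0)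
  row true  = ∑-indicator c (s≤s b≤n)
  row false = ∑-zero (suc n)

zeroAt : Vec2 → (Vec2 → ℕ) → Vec2 → ℕ
zeroAt p h q = if q == p then 0 else h q

zeroAt-≢ : ∀ {p q} (h : Vec2 → ℕ) → p ≢ q → zeroAt p h q ≡ h q
zeroAt-≢ h p≢q = cong (λ b → if b then 0 else h _) (==-≢ (p≢q ∘ sym))

zeroAt-self : ∀ p (h : Vec2 → ℕ) → zeroAt p h p ≡ 0
zeroAt-self p h = cong (λ b → if b then 0 else h p) (==-refl p)

sum-map-zeroAt : ∀ {p ps} (h : Vec2 → ℕ) → All (p ≢_) ps → sum (map (zeroAt p h) ps) ≡ sum (map h ps)
sum-map-zeroAt h p∉ps = cong sum (map-cong-local (All.map (zeroAt-≢ h) p∉ps))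

∑≤-pick : ∀ {m n p} (h : Vec2 → ℕ) → p ≤ᵥ (m , n) →
          ∑≤ (m , n) h ≡ h p + ∑≤ (m , n) (zeroAt p h)
∑≤-pick {m} {n} {p} h p≤v = begin
  ∑≤ v h                               ≡⟨ ∑≤-cong {m} {n} (λ {q} _ → split q) ⟩
  ∑≤ v (λ q → δ q + zeroAt p h q)      ≡⟨ ∑≤-distrib-+ {m} {n} δ (zeroAt p h) ⟩
  ∑≤ v δ + ∑≤ v (zeroAt p h)
    ≡⟨ cong (_+ ∑≤ v (zeroAt p h)) (∑≤-indicator {m} {n} (h p) p≤v) ⟩
  h p + ∑≤ v (zeroAt p h)              ∎
  where
  open ≡-Reasoning
  v : Vec2
  v = m , n
  δ : Vec2 → ℕ
  δ q = if q == p then h p else 0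
  split : ∀ q → h q ≡ δ q + zeroAt p h q
  split q with q ≟ᵥ p
  ... | yes refl = trans (sym (+-identityʳ (h p)))
                         (cong (λ b → (if b then h p else 0) + (if b then 0 else h p)) (sym (==-refl p)))
  ... | no  q≢p  = cong (λ b → (if b then h p else 0) + (if b then 0 else h q)) (sym (==-≢ q≢p))

∑≤-≥ : ∀ {m n ps} (h : Vec2 → ℕ) → Unique ps → All (_≤ᵥ (m , n)) ps →
       sum (map h ps) ≤ ∑≤ (m , n) h
∑≤-≥ {ps = []}     h []              []            = z≤n
∑≤-≥ {m} {n} {p ∷ ps} h (p∉ps ∷ unique) (p≤v ∷ ps≤v) = begin
  h p + sum (map h ps)             ≡⟨ cong (h p +_) (sum-map-zeroAt h p∉ps) ⟨
  h p + sum (map (zeroAt p h) ps)  ≤⟨ +-monoʳ-≤ (h p) (∑≤-≥ (zeroAt p h) unique ps≤v) ⟩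
  h p + ∑≤ (m , n) (zeroAt p h)    ≡⟨ ∑≤-pick h p≤v ⟨
  ∑≤ (m , n) h                     ∎
  where open ≤-Reasoning

∑≤-supported : ∀ {m n ps} (h : Vec2 → ℕ) → Unique ps → All (_≤ᵥ (m , n)) ps →
               (∀ {q} → q ≤ᵥ (m , n) → h q ≢ 0 → q ∈ ps) → ∑≤ (m , n) h ≡ sum (map h ps)
∑≤-supported {m} {n} {[]} h [] [] supp = ∑≤-zero {m} {n} vanish
  where
  vanish : ∀ {q} → q ≤ᵥ (m , n) → h q ≡ 0
  vanish {q} q≤v with h q ≟ 0
  ... | yes hq≡0 = hq≡0
  ... | no  hq≢0 with () ← supp q≤v hq≢0
∑≤-supported {m} {n} {p ∷ ps} h (p∉ps ∷ unique) (p≤v ∷ ps≤v) supp = begin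
  ∑≤ (m , n) h                     ≡⟨ ∑≤-pick h p≤v ⟩
  h p + ∑≤ (m , n) (zeroAt p h)    ≡⟨ cong (h p +_) (∑≤-supported (zeroAt p h) unique ps≤v supp′) ⟩
  h p + sum (map (zeroAt p h) ps)  ≡⟨ cong (h p +_) (sum-map-zeroAt h p∉ps) ⟩
  h p + sum (map h ps)             ∎
  where
  open ≡-Reasoning
  supp′ : ∀ {q} → q ≤ᵥ (m , n) → zeroAt p h q ≢ 0 → q ∈ ps
  supp′ {q} q≤v hq≢0 with p ≟ᵥ q
  ... | yes refl = contradiction (zeroAt-self p h) hq≢0
  ... | no  p≢q with supp q≤v (hq≢0 ∘ trans (zeroAt-≢ h p≢q))
  ...   | here q≡p   = contradiction (sym q≡p) p≢q
  ...   | there q∈ps = q∈ps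

sum-map-ones : ∀ {ps} (h : Vec2 → ℕ) → All (λ q → h q ≡ 1) ps → sum (map h ps) ≡ length ps
sum-map-ones h []             = refl
sum-map-ones h (hp≡1 ∷ hps≡1) = cong₂ _+_ hp≡1 (sum-map-ones h hps≡1)

-- The Ulam recursion

isGen : List Vec2 → Vec2 → Bool
isGen us v = any (_== v) us

isGen-∈ : ∀ us {v} → isGen us v ≡ true → v ∈ us
isGen-∈ (u ∷ us) {v} isGen≡true with u ≟ᵥ v
... | yes refl = here refl
... | no  u≢v  = there (isGen-∈ us (trans (cong (_∨ isGen us v) (sym (==-≢ u≢v))) isGen≡true))

∈⇒isGen : ∀ {us v} → v ∈ us → isGen us v ≡ true
∈⇒isGen {_ ∷ us} {v} (here refl)  = cong (_∨ isGen us v) (==-refl v)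
∈⇒isGen {u ∷ us} {v} (there v∈us) = trans (cong ((u == v) ∨_) (∈⇒isGen v∈us)) (∨-zeroʳ (u == v))

∉⇒isGen : ∀ {us v} → ¬ v ∈ us → isGen us v ≡ false
∉⇒isGen {us} v∉us = ¬-not (v∉us ∘ isGen-∈ us)

isGen-swap : ∀ us v → isGen (map swap us) (swap v) ≡ isGen us v
isGen-swap []       v = refl
isGen-swap (u ∷ us) v = cong₂ _∨_ (==-swap u v) (isGen-swap us v)

reps : (Vec2 → Bool) → Vec2 → Vec2 → ℕ
reps U v q = if q == (v ∸ᵥ q) then 0 else (if U q ∧ U (v ∸ᵥ q) then 1 else 0)

memF-suc : ∀ s us m n →
  memF (suc s) us m n ≡ isGen us (m , n) ∨ (∑≤ (m , n) (reps (uncurry (memF s us)) (m , n)) ≡ᵇ 2)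
memF-suc s us m n = cong (λ k → isGen us (m , n) ∨ (k ≡ᵇ 2))
  (trans (sum-map-applyUpTo (λ i → sum (map (term i) (upTo (suc n)))) id (suc m))
         (∑-cong (suc m) λ {i} _ → sum-map-applyUpTo (term i) id (suc n)))
  where
  term : ℕ → ℕ → ℕ
  term i j = reps (uncurry (memF s us)) (m , n) (i , j)

memF-origin : ∀ {us} → isGen us (0 , 0) ≡ false → ∀ s → memF s us 0 0 ≡ false
memF-origin      origin∉ zero    = refl
memF-origin {us} origin∉ (suc s) = trans (∨-identityʳ (isGen us (0 , 0))) origin∉

reps-agree : ∀ (U V : Vec2 → Bool) {v} → U (0 , 0) ≡ false → V (0 , 0) ≡ false →
  (∀ {w} → ‖ w ‖ < ‖ v ‖ → U w ≡ V w) → ∀ {q} → q ≤ᵥ v → reps U v q ≡ reps V v q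
reps-agree U V {v} U₀ V₀ U≡V {q} q≤v =
  cong (λ b → if q == (v ∸ᵥ q) then 0 else (if b then 1 else 0)) agree
  where
  agree : (U q ∧ U (v ∸ᵥ q)) ≡ (V q ∧ V (v ∸ᵥ q))
  agree with split-‖‖ q≤v
  ... | inj₁ refl = trans (cong (_∧ U (v ∸ᵥ q)) U₀) (sym (cong (_∧ V (v ∸ᵥ q)) V₀))
  ... | inj₂ (inj₁ v∸q≡0) rewrite v∸q≡0 =
        trans (trans (cong (U q ∧_) U₀) (∧-zeroʳ (U q))) (sym (trans (cong (V q ∧_) V₀) (∧-zeroʳ (V q))))
  ... | inj₂ (inj₂ (q<v , v∸q<v)) = cong₂ _∧_ (U≡V q<v) (U≡V v∸q<v)

memF-swap : ∀ s us v → uncurry (memF s (map swap us)) (swap v) ≡ uncurry (memF s us) v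
memF-swap zero    us v       = refl
memF-swap (suc s) us (m , n) = begin
  memF (suc s) (map swap us) n m                                       ≡⟨ memF-suc s _ n m ⟩
  isGen (map swap us) (n , m) ∨ (∑≤ (n , m) (reps U′ (n , m)) ≡ᵇ 2)
    ≡⟨ cong₂ (λ g k → g ∨ (k ≡ᵇ 2)) (isGen-swap us (m , n)) counts ⟩
  isGen us (m , n) ∨ (∑≤ (m , n) (reps U (m , n)) ≡ᵇ 2)              ≡⟨ memF-suc s us m n ⟨
  memF (suc s) us m n                                                  ∎
  where
  open ≡-Reasoning
  U U′ : Vec2 → Bool
  U  = uncurry (memF s us)
  U′ = uncurry (memF s (map swap us))
  reps-swap : ∀ q → reps U′ (n , m) (swap q) ≡ reps U (m , n) q
  reps-swap q = cong₂ (λ g b → if g then 0 else (if b then 1 else 0))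
    (==-swap q ((m , n) ∸ᵥ q)) (cong₂ _∧_ (memF-swap s us q) (memF-swap s us ((m , n) ∸ᵥ q)))
  counts : ∑≤ (n , m) (reps U′ (n , m)) ≡ ∑≤ (m , n) (reps U (m , n))
  counts = trans (∑≤-swap {m} {n} (reps U′ (n , m))) (∑≤-cong {m} {n} λ {q} _ → reps-swap q)

-- Chosen so that  v ∈U us  is  v ∈Uᵇ us ≡ true  by definition.
_∈Uᵇ_ : Vec2 → List Vec2 → Bool
(m , n) ∈Uᵇ us = memF (suc (m + n)) us m n

_∉U_ : Vec2 → List Vec2 → Set
v ∉U us = v ∈Uᵇ us ≡ false

#reps : List Vec2 → Vec2 → ℕ
#reps us v = ∑≤ v (reps (_∈Uᵇ us) v)

∈Uᵇ-swap : ∀ us v → swap v ∈Uᵇ map swap us ≡ v ∈Uᵇ us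
∈Uᵇ-swap us (m , n) =
  trans (cong (λ k → memF (suc k) (map swap us) n m) (+-comm n m)) (memF-swap (suc (m + n)) us (m , n))

-- Representations

record Summand (us : List Vec2) (v q : Vec2) : Set where
  constructor summand
  field
    partner  : Vec2
    sums     : q +ᵥ partner ≡ v
    distinct : q ≢ partner
    left∈U   : q ∈U us
    right∈U  : partner ∈U us

summand-flip : ∀ {us v q} (s : Summand us v q) → Summand us v (Summand.partner s)
summand-flip {q = q} (summand w sums distinct q∈U w∈U) =
  summand q (trans (+ᵥ-comm w q) sums) (distinct ∘ sym) w∈U q∈U

reps-summand : ∀ {us v q} → Summand us v q → reps (_∈Uᵇ us) v q ≡ 1
reps-summand {us} {v} {q} (summand w q+w≡v q≢w q∈U w∈U) =
  trans (cong (λ w → if q == w then 0 else (if q ∈Uᵇ us ∧ w ∈Uᵇ us then 1 else 0)) (+ᵥ⇒∸ᵥ q+w≡v))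
        (cong₂ (λ g b → if g then 0 else (if b then 1 else 0)) (==-≢ q≢w) (cong₂ _∧_ q∈U w∈U))

if-0-1≢0 : ∀ g b → (if g then 0 else (if b then 1 else 0)) ≢ 0 → g ≡ false × b ≡ true
if-0-1≢0 false true  _  = refl , refl
if-0-1≢0 false false ≢0 = contradiction refl ≢0
if-0-1≢0 true  _     ≢0 = contradiction refl ≢0

reps≢0⇒summand : ∀ {us v q} → q ≤ᵥ v → reps (_∈Uᵇ us) v q ≢ 0 → Summand us v q
reps≢0⇒summand {us} {v} {q} q≤v reps≢0 =
  summand (v ∸ᵥ q) (≤ᵥ⇒+ᵥ∸ᵥ q≤v) distinct (∧-conicalˡ _ _ both∈U) (∧-conicalʳ _ _ both∈U)
  where
  shape : (q == (v ∸ᵥ q)) ≡ false × (q ∈Uᵇ us ∧ (v ∸ᵥ q) ∈Uᵇ us) ≡ true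
  shape = if-0-1≢0 _ _ reps≢0
  both∈U : (q ∈Uᵇ us ∧ (v ∸ᵥ q) ∈Uᵇ us) ≡ true
  both∈U = proj₂ shape
  distinct : q ≢ v ∸ᵥ q
  distinct q≡w with () ← trans (sym (dec-true (q ≟ᵥ (v ∸ᵥ q)) q≡w)) (proj₁ shape)

#reps-≥ : ∀ {us v ps} → Unique ps → All (Summand us v) ps → length ps ≤ #reps us v
#reps-≥ {us} {m , n} unique summands =
  subst (_≤ #reps us (m , n)) (sum-map-ones _ (All.map reps-summand summands))
        (∑≤-≥ (reps (_∈Uᵇ us) (m , n)) unique (All.map (+ᵥ⇒≤ᵥ ∘ Summand.sums) summands))

#reps-≡ : ∀ {us v ps} → Unique ps → All (Summand us v) ps → (∀ {q} → Summand us v q → q ∈ ps) →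
          #reps us v ≡ length ps
#reps-≡ {us} {m , n} unique summands complete =
  trans (∑≤-supported (reps (_∈Uᵇ us) (m , n)) unique (All.map (+ᵥ⇒≤ᵥ ∘ Summand.sums) summands)
                      λ q≤v reps≢0 → complete (reps≢0⇒summand q≤v reps≢0))
        (sum-map-ones _ (All.map reps-summand summands))

∨≡true⇒⊎ : ∀ a {b} → a ∨ b ≡ true → a ≡ true ⊎ b ≡ true
∨≡true⇒⊎ true  _      = inj₁ refl
∨≡true⇒⊎ false b≡true = inj₂ b≡true

module Membership {us : List Vec2} (origin∉ : isGen us (0 , 0) ≡ false) where

  -- (0,0) ∉ U, so both parts of a representation of v are shorter than v: fuel beyond ‖ v ‖ is enough.
  memF-fuel : ∀ s t {v} → ‖ v ‖ < s → ‖ v ‖ < t → uncurry (memF s us) v ≡ uncurry (memF t us) v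
  memF-fuel (suc s) (suc t) {m , n} v<s v<t = begin
    memF (suc s) us m n                                     ≡⟨ memF-suc s us m n ⟩
    isGen us (m , n) ∨ (∑≤ (m , n) (reps Uₛ (m , n)) ≡ᵇ 2)
      ≡⟨ cong (λ k → isGen us (m , n) ∨ (k ≡ᵇ 2)) (∑≤-cong {m} {n} agree) ⟩
    isGen us (m , n) ∨ (∑≤ (m , n) (reps Uₜ (m , n)) ≡ᵇ 2) ≡⟨ memF-suc t us m n ⟨
    memF (suc t) us m n                                     ∎
    where
    open ≡-Reasoning
    Uₛ Uₜ : Vec2 → Bool
    Uₛ = uncurry (memF s us)
    Uₜ = uncurry (memF t us)
    agree : ∀ {q} → q ≤ᵥ (m , n) → reps Uₛ (m , n) q ≡ reps Uₜ (m , n) q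
    agree = reps-agree Uₛ Uₜ (memF-origin origin∉ s) (memF-origin origin∉ t)
      λ w<v → memF-fuel s t (<-≤-trans w<v (≤-pred v<s)) (<-≤-trans w<v (≤-pred v<t))

  ∈Uᵇ-unfold : ∀ v → v ∈Uᵇ us ≡ isGen us v ∨ (#reps us v ≡ᵇ 2)
  ∈Uᵇ-unfold (m , n) =
    trans (memF-suc (m + n) us m n) (cong (λ k → isGen us (m , n) ∨ (k ≡ᵇ 2)) (∑≤-cong {m} {n} agree))
    where
    agree : ∀ {q} → q ≤ᵥ (m , n) → reps (uncurry (memF (m + n) us)) (m , n) q ≡ reps (_∈Uᵇ us) (m , n) q
    agree = reps-agree _ _ (memF-origin {us} origin∉ (m + n)) (memF-origin {us} origin∉ 1)
      λ {w} w<v → memF-fuel (m + n) (suc ‖ w ‖) {w} w<v ≤-refl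

  origin∉U : (0 , 0) ∉U us
  origin∉U = memF-origin {us} origin∉ 1

  ∉U⇒¬∈U : ∀ {v} → v ∉U us → ¬ v ∈U us
  ∉U⇒¬∈U v∉U v∈U = contradiction (trans (sym v∈U) v∉U) λ ()

  ∈U⇒≢origin : ∀ {v} → v ∈U us → v ≢ (0 , 0)
  ∈U⇒≢origin v∈U refl = ∉U⇒¬∈U origin∉U v∈U

  ∈⇒∈U : ∀ {v} → v ∈ us → v ∈U us
  ∈⇒∈U {v} v∈us = trans (∈Uᵇ-unfold v) (cong (_∨ (#reps us v ≡ᵇ 2)) (∈⇒isGen v∈us))

  #reps≡2⇒∈U : ∀ {v} → #reps us v ≡ 2 → v ∈U us
  #reps≡2⇒∈U {v} #reps≡2 =
    trans (∈Uᵇ-unfold v) (trans (cong (λ k → isGen us v ∨ (k ≡ᵇ 2)) #reps≡2) (∨-zeroʳ _))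

  ∉U-intro : ∀ {v} → ¬ v ∈ us → #reps us v ≢ 2 → v ∉U us
  ∉U-intro {v} v∉us #reps≢2 =
    trans (∈Uᵇ-unfold v) (cong₂ _∨_ (∉⇒isGen v∉us) (dec-false (#reps us v ≟ 2) #reps≢2))

  #reps≥3⇒∉U : ∀ {v} → ¬ v ∈ us → 3 ≤ #reps us v → v ∉U us
  #reps≥3⇒∉U v∉us 3≤#reps =
    ∉U-intro v∉us λ #reps≡2 → <⇒≱ (s≤s ≤-refl) (subst (3 ≤_) #reps≡2 3≤#reps)

  ∈U-cases : ∀ {v} → v ∈U us → v ∈ us ⊎ #reps us v ≡ 2
  ∈U-cases {v} v∈U with ∨≡true⇒⊎ (isGen us v) (trans (sym (∈Uᵇ-unfold v)) v∈U)
  ... | inj₁ isGen≡true = inj₁ (isGen-∈ us isGen≡true)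
  ... | inj₂ #reps≡ᵇ2   = inj₂ (≡ᵇ⇒≡ (#reps us v) 2 (subst T (sym #reps≡ᵇ2) tt))

-- Geometry of U

record Generators (P : ℕ) (us : List Vec2) : Set where
  field
    2≤P     : 2 ≤ P
    e₁∈     : (1 , 0) ∈ us
    e₂∈     : (0 , 1) ∈ us
    axis₁   : ∀ {m} → (m , 0) ∈ us → m ≡ 1
    axis₂   : ∀ {n} → (0 , n) ∈ us → n ≡ 1
    bounded : ∀ {v} → v ∈ us → v ≤ᵥ (P , P)

  origin∉ : isGen us (0 , 0) ≡ false
  origin∉ = ∉⇒isGen λ origin∈ → contradiction (axis₁ origin∈) λ ()

  above₁ : ∀ {m n} → P < m → ¬ (m , n) ∈ us
  above₁ P<m v∈us = <⇒≱ P<m (proj₁ (bounded v∈us))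

  above₂ : ∀ {m n} → P < n → ¬ (m , n) ∈ us
  above₂ P<n v∈us = <⇒≱ P<n (proj₂ (bounded v∈us))

∈-map-swap⁻ : ∀ {us : List Vec2} {v} → v ∈ map swap us → swap v ∈ us
∈-map-swap⁻ v∈ with _ , u∈us , refl ← ∈-map⁻ swap v∈ = u∈us

swapᴳ : ∀ {P us} → Generators P us → Generators P (map swap us)
swapᴳ {P} {us} G = record
  { 2≤P     = 2≤P
  ; e₁∈     = ∈-map⁺ swap e₂∈
  ; e₂∈     = ∈-map⁺ swap e₁∈
  ; axis₁   = axis₂ ∘ ∈-map-swap⁻
  ; axis₂   = axis₁ ∘ ∈-map-swap⁻
  ; bounded = swap ∘ bounded ∘ ∈-map-swap⁻
  }
  where open Generators G

module _ {P : ℕ} {us : List Vec2} (G : Generators P us) where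
  open Generators G
  open Membership {us} origin∉

  axis₂-∈U : ∀ {n} → (0 , n) ∈U us → n ≡ 1
  axis₂-∈U {n} = <-rec (λ n → (0 , n) ∈U us → n ≡ 1) step n
    where
    step : ∀ n → (∀ {y} → y < n → (0 , y) ∈U us → y ≡ 1) → (0 , n) ∈U us → n ≡ 1
    step n IH 0n∈U with ∈U-cases 0n∈U
    ... | inj₁ 0n∈us   = axis₂ 0n∈us
    ... | inj₂ #reps≡2 = contradiction (trans (sym #reps≡2) (#reps-≡ [] [] no-summand)) λ ()
      where
      no-summand : ∀ {q} → Summand us (0 , n) q → q ∈ []
      no-summand {i , y} (summand (a , b) sums q≢w q∈U w∈U)
        with i+a≡0 , y+b≡n ← ,-injective sums
        with refl ← m+n≡0⇒m≡0 i i+a≡0 | refl ← m+n≡0⇒n≡0 i i+a≡0 =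
        contradiction (cong (0 ,_) (trans (IH y<n q∈U) (sym (IH b<n w∈U)))) q≢w
        where
        y<n : y < n
        y<n = +≡⇒< y+b≡n λ { refl → ∈U⇒≢origin w∈U refl }
        b<n : b < n
        b<n = +≡⇒< (trans (+-comm b y) y+b≡n) λ { refl → ∈U⇒≢origin q∈U refl }

axis₁-∈U : ∀ {P us} → Generators P us → ∀ {m} → (m , 0) ∈U us → m ≡ 1
axis₁-∈U {us = us} G {m} m0∈U = axis₂-∈U (swapᴳ G) (trans (∈Uᵇ-swap us (m , 0)) m0∈U)

module _ {P : ℕ} {us : List Vec2} (G : Generators P us) where
  open Generators G
  open Membership {us} origin∉

  row₁-∈U : ∀ x → (x , 1) ∈U us
  row₁-∈U zero    = ∈⇒∈U e₂∈
  row₁-∈U (suc x) =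
    #reps≡2⇒∈U (#reps-≡ ((≢₂ (λ ()) ∷ []) ∷ [] ∷ []) (e₁+x₁ ∷ summand-flip e₁+x₁ ∷ []) complete)
    where
    e₁+x₁ : Summand us (suc x , 1) (1 , 0)
    e₁+x₁ = summand (x , 1) refl (≢₂ λ ()) (∈⇒∈U e₁∈) (row₁-∈U x)
    complete : ∀ {q} → Summand us (suc x , 1) q → q ∈ (1 , 0) ∷ (x , 1) ∷ []
    complete {i , 0} (summand _ _ _ q∈U _) with refl ← axis₁-∈U G q∈U = here refl
    complete {i , 1} (summand (a , b) sums _ _ w∈U)
      with i+a≡1+x , 1+b≡1 ← ,-injective sums
      with refl ← suc-injective 1+b≡1
      with refl ← axis₁-∈U G w∈U
      = there (here (cong (_, 1) (suc-injective (trans (+-comm 1 i) i+a≡1+x))))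
    complete {i , suc (suc y)} (summand _ sums _ _ _) with () ← proj₂ (,-injective sums)

column₁-∈U : ∀ {P us} → Generators P us → ∀ y → (1 , y) ∈U us
column₁-∈U {us = us} G y = trans (sym (∈Uᵇ-swap us (1 , y))) (row₁-∈U (swapᴳ G) y)

module _ {P : ℕ} {us : List Vec2} (G : Generators P us) where
  open Generators G
  open Membership {us} origin∉

  summand-row₁ : ∀ {c m n} → (c , n) ∈U us → c ≤ m → n ≢ 1 → Summand us (m , suc n) (c , n)
  summand-row₁ {c} {m} {n} cn∈U c≤m n≢1 =
    summand (m ∸ c , 1) (cong₂ _,_ (m+[n∸m]≡n c≤m) (+-comm n 1)) (≢₂ n≢1) cn∈U (row₁-∈U G (m ∸ c))

  next-row-∉U : ∀ {c m n} → 2 ≤ c → c ≤ m → 2 ≤ n → (c , n) ∈U us → ¬ (m , suc n) ∈ us →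
                (m , suc n) ∉U us
  next-row-∉U {c} {m} {n} 2≤c c≤m 2≤n cn∈U v∉us =
    #reps≥3⇒∉U v∉us (#reps-≥ unique (s₁ ∷ summand-flip s₁ ∷ summand-row₁ cn∈U c≤m n≢1 ∷ []))
    where
    n≢1 : n ≢ 1
    n≢1 = >⇒≢ 2≤n
    s₁ : Summand us (m , suc n) (1 , n)
    s₁ = summand-row₁ (column₁-∈U G n) (≤-trans (s≤s z≤n) (≤-trans 2≤c c≤m)) n≢1
    unique : Unique ((1 , n) ∷ (m ∸ 1 , 1) ∷ (c , n) ∷ [])
    unique = (≢₂ n≢1 ∷ ≢₁ (<⇒≢ 2≤c) ∷ []) ∷ (≢₂ (≢-sym n≢1) ∷ []) ∷ [] ∷ []

  column₂-∉U : ∀ {y} → 2 ≤ y → ¬ (2 , y) ∈ us → (2 , y) ∉U us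
  column₂-∉U {1} (s≤s ())
  column₂-∉U {2} _ v∉us =
    #reps≥3⇒∉U v∉us (#reps-≥ unique (s₁ ∷ summand-flip s₁ ∷ s₃ ∷ []))
    where
    s₁ : Summand us (2 , 2) (1 , 0)
    s₁ = summand (1 , 2) refl (≢₂ λ ()) (∈⇒∈U e₁∈) (column₁-∈U G 2)
    s₃ : Summand us (2 , 2) (2 , 1)
    s₃ = summand (0 , 1) refl (≢₁ λ ()) (row₁-∈U G 2) (∈⇒∈U e₂∈)
    unique : Unique ((1 , 0) ∷ (1 , 2) ∷ (2 , 1) ∷ [])
    unique = (≢₂ (λ ()) ∷ ≢₁ (λ ()) ∷ []) ∷ (≢₁ (λ ()) ∷ []) ∷ [] ∷ []
  column₂-∉U {suc (suc (suc y))} _ v∉us =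
    #reps≥3⇒∉U v∉us (#reps-≥ unique (s₁ ∷ summand-flip s₁ ∷ s₃ ∷ []))
    where
    s₁ : Summand us (2 , 3 + y) (1 , 0)
    s₁ = summand (1 , 3 + y) refl (≢₂ λ ()) (∈⇒∈U e₁∈) (column₁-∈U G (3 + y))
    s₃ : Summand us (2 , 3 + y) (1 , 1)
    s₃ = summand (1 , 2 + y) refl (≢₂ λ ()) (row₁-∈U G 1) (column₁-∈U G (2 + y))
    unique : Unique ((1 , 0) ∷ (1 , 3 + y) ∷ (1 , 1) ∷ [])
    unique = (≢₂ (λ ()) ∷ ≢₂ (λ ()) ∷ []) ∷ (≢₂ (λ ()) ∷ []) ∷ [] ∷ []

next-column-∉U : ∀ {P us} → Generators P us → ∀ {c m n} → 2 ≤ c → c ≤ m → 2 ≤ n →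
                 (n , c) ∈U us → ¬ (suc n , m) ∈ us → (suc n , m) ∉U us
next-column-∉U {us = us} G {c} {m} {n} 2≤c c≤m 2≤n nc∈U v∉us =
  trans (sym (∈Uᵇ-swap us (suc n , m)))
        (next-row-∉U (swapᴳ G) 2≤c c≤m 2≤n (trans (∈Uᵇ-swap us (n , c)) nc∈U) (v∉us ∘ ∈-map-swap⁻))

-- Columns beyond P

first-failure : ∀ {Q : ℕ → Set} → Decidable Q → ∀ t → ¬ (∀ {k} → k < t → Q k) →
                ∃ λ j → ¬ Q j × (∀ {k} → k < j → Q k)
first-failure Q? zero    none = contradiction (λ ()) none
first-failure {Q} Q? (suc t) none with allUpTo? Q? t
... | no  ¬all = first-failure Q? t ¬all
... | yes all  = t , (λ Qt → none (extend Qt)) , all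
  where
  extend : Q t → ∀ {k} → k < suc t → Q k
  extend Qt k<1+t with m≤n⇒m<n∨m≡n (≤-pred k<1+t)
  ... | inj₁ k<t  = all k<t
  ... | inj₂ refl = Qt

even⊎odd : ∀ d → ∃ λ k → d ≡ k * 2 ⊎ d ≡ suc (k * 2)
even⊎odd zero = 0 , inj₁ refl
even⊎odd (suc d) with even⊎odd d
... | k , inj₁ refl = k , inj₂ refl
... | k , inj₂ refl = suc k , inj₁ refl

module _ {P : ℕ} {us : List Vec2} (G : Generators P us) where
  open Generators G
  open Membership {us} origin∉

  Tall : ℕ → Set
  Tall i = ∃ λ y → y < suc P × (2 ≤ y × (i , y) ∈U us)

  tall? : Decidable Tall
  tall? i = anyUpTo? (λ y → (2 ≤? y) ×-dec ((i , y) ∈Uᵇ us Bool.≟ true)) (suc P)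

  Low : ℕ → Set
  Low i = ∀ {y} → (i , y) ∈U us → y ≤ P

  column₂-low : Low 2
  column₂-low {y} 2y∈U with y ≤? P
  ... | yes y≤P = y≤P
  ... | no  y≰P = contradiction 2y∈U (∉U⇒¬∈U (column₂-∉U G 2≤y (above₂ (≰⇒> y≰P))))
    where
    2≤y : 2 ≤ y
    2≤y = ≤-trans 2≤P (<⇒≤ (≰⇒> y≰P))

  tall⇒low-next : ∀ {i} → 2 ≤ i → Tall i → Low (suc i)
  tall⇒low-next 2≤i (y₀ , y₀<1+P , 2≤y₀ , iy₀∈U) {y} v∈U with y ≤? P
  ... | yes y≤P = y≤P
  ... | no  y≰P = contradiction v∈U
    (∉U⇒¬∈U (next-column-∉U G 2≤y₀ y₀≤y 2≤i iy₀∈U (above₂ (≰⇒> y≰P))))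
    where
    y₀≤y : y₀ ≤ y
    y₀≤y = ≤-trans (≤-pred y₀<1+P) (<⇒≤ (≰⇒> y≰P))

  heights-decrease : ∀ {i y₀ y} → P ≤ i → 2 ≤ y₀ → (i , y₀) ∈U us → (suc i , y) ∈U us → y < y₀
  heights-decrease {i} {y₀} {y} P≤i 2≤y₀ iy₀∈U v∈U with y <? y₀
  ... | yes y<y₀ = y<y₀
  ... | no  y≮y₀ = contradiction v∈U
    (∉U⇒¬∈U (next-column-∉U G 2≤y₀ (≮⇒≥ y≮y₀) (≤-trans 2≤P P≤i) iy₀∈U (above₁ (s≤s P≤i))))

  descent : (∀ {i} → P ≤ i → i ≤ P + P → Tall i) →
            ∀ {k} → k ≤ P → ∃ λ y → 2 ≤ y × y + k ≤ P × (P + k , y) ∈U us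
  descent tall {zero} _ with y , y<1+P , 2≤y , v∈U ← tall (m≤m+n P 0) (+-monoʳ-≤ P z≤n) =
    y , 2≤y , subst (_≤ P) (sym (+-identityʳ y)) (≤-pred y<1+P) , v∈U
  descent tall {suc k} 1+k≤P
    with y , 2≤y , y+k≤P , v∈U ← descent tall (<⇒≤ 1+k≤P)
    with y′ , _ , 2≤y′ , v′∈U ← tall (m≤m+n P (suc k)) (+-monoʳ-≤ P 1+k≤P) =
    y′ , 2≤y′ , subst (_≤ P) (sym (+-suc y′ k)) (≤-trans (+-monoˡ-≤ k y′<y) y+k≤P) , v′∈U
    where
    y′<y : y′ < y
    y′<y = heights-decrease (m≤m+n P k) 2≤y v∈U (subst (λ i → (i , y′) ∈U us) (+-suc P k) v′∈U)

  some-column-short : ¬ (∀ {k} → k < P + P → Tall (2 + k))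
  some-column-short tall = no-room (descent tall′ ≤-refl)
    where
    tall′ : ∀ {i} → P ≤ i → i ≤ P + P → Tall i
    tall′ {i} P≤i i≤2P =
      subst Tall (m+[n∸m]≡n 2≤i) (tall (<-≤-trans (∸-monoʳ-< {i} {2} {0} (s≤s z≤n) 2≤i) i≤2P))
      where
      2≤i : 2 ≤ i
      2≤i = ≤-trans 2≤P P≤i
    no-room : ¬ (∃ λ y → 2 ≤ y × y + P ≤ P × (P + P , y) ∈U us)
    no-room (y , 2≤y , y+P≤P , _) = <⇒≱ (m<n+m P (≤-trans (s≤s z≤n) 2≤y)) y+P≤P

  lows-before : ∀ {k} → (∀ {k′} → k′ < k → Tall (2 + k′)) → ∀ {k′} → k′ ≤ k → Low (2 + k′)
  lows-before tall {zero}   _      = column₂-low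
  lows-before tall {suc k′} 1+k′≤k = tall⇒low-next (s≤s (s≤s z≤n)) (tall 1+k′≤k)

  short-column-singleton : ∀ {j} → 2 ≤ j → ¬ Tall j → Low j → ∀ {y} → (j , y) ∈U us → y ≡ 1
  short-column-singleton 2≤j _     _   {0}           j0∈U = contradiction (axis₁-∈U G j0∈U) (>⇒≢ 2≤j)
  short-column-singleton _   _     _   {1}           _    = refl
  short-column-singleton _   short low {suc (suc y)} jy∈U =
    contradiction (suc (suc y) , s≤s (low jy∈U) , s≤s (s≤s z≤n) , jy∈U) short

module _ {P : ℕ} {us : List Vec2} (G : Generators P us) {j : ℕ} (2≤j : 2 ≤ j)
         (singleton : ∀ {y} → (j , y) ∈U us → y ≡ 1)
         (low : ∀ {i y} → 2 ≤ i → i < j → (i , y) ∈U us → y ≤ P) where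
  open Generators G
  open Membership {us} origin∉

  -- Columns 0 and j are {(0,1)} and {(j,1)}, and the columns strictly between 1 and j stay below
  -- P + 1, while n + 1 > P + P.
  summands-after-short : ∀ {n q} → P + P ≤ n → Summand us (suc j , suc n) q →
                         q ∈ (0 , 1) ∷ (1 , n) ∷ (j , 1) ∷ (suc j , n) ∷ []
  summands-after-short {q = 0 , y} _ (summand _ _ _ q∈U _) with refl ← axis₂-∈U G q∈U = here refl
  summands-after-short {q = i , y} _ (summand (0 , b) sums _ _ w∈U)
    with i+0≡1+j , y+b≡1+n ← ,-injective sums
    with refl ← axis₂-∈U G w∈U
    = there (there (there (here (cong₂ _,_ (trans (sym (+-identityʳ i)) i+0≡1+j)
                                             (suc-injective (trans (+-comm 1 y) y+b≡1+n))))))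
  summands-after-short {q = 1 , y} _ (summand (a , b) sums _ _ w∈U)
    with 1+a≡1+j , y+b≡1+n ← ,-injective sums
    with refl ← suc-injective 1+a≡1+j
    with refl ← singleton w∈U
    = there (here (cong (1 ,_) (suc-injective (trans (+-comm 1 y) y+b≡1+n))))
  summands-after-short {q = i , y} _ (summand (1 , b) sums _ q∈U _)
    with i+1≡1+j , _ ← ,-injective sums
    with refl ← suc-injective (trans (+-comm 1 i) i+1≡1+j)
    with refl ← singleton q∈U
    = there (there (here refl))
  summands-after-short {n} {q = suc (suc i) , y} 2P≤n (summand (suc (suc a) , b) sums _ q∈U w∈U)
    with i+a≡1+j , y+b≡1+n ← ,-injective sums
    = contradiction (≤-trans (≤-reflexive (sym y+b≡1+n)) (≤-trans (+-mono-≤ y≤P b≤P) 2P≤n)) 1+n≰n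
    where
    below : ∀ {x z} → x + suc (suc z) ≡ suc j → x < j
    below {x} {z} x+z≡1+j = +≡⇒< (suc-injective (trans (sym (+-suc x (suc z))) x+z≡1+j)) λ ()
    y≤P : y ≤ P
    y≤P = low (s≤s (s≤s z≤n)) (below i+a≡1+j) q∈U
    b≤P : b ≤ P
    b≤P = low (s≤s (s≤s z≤n)) (below (trans (+-comm (suc (suc a)) (suc (suc i))) i+a≡1+j)) w∈U

  private
    summand-e₂ : ∀ {n} → (suc j , n) ∈U us → Summand us (suc j , suc n) (0 , 1)
    summand-e₂ {n} v∈U = summand (suc j , n) refl (≢₁ λ ()) (∈⇒∈U e₂∈) v∈U

    summand-column₁ : ∀ {n} → Summand us (suc j , suc n) (1 , n)
    summand-column₁ {n} =
      summand (j , 1) (cong (suc j ,_) (+-comm n 1)) (≢₁ (<⇒≢ 2≤j)) (column₁-∈U G n) (row₁-∈U G j)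

  alternate-∉U : ∀ {n} → P + P ≤ n → (suc j , n) ∈U us → (suc j , suc n) ∉U us
  alternate-∉U {n} 2P≤n v∈U = ∉U-intro (above₂ (s≤s (≤-trans (m≤m+n P P) 2P≤n))) λ #reps≡2 →
    contradiction (trans (sym #reps≡2) (#reps-≡ unique summands (summands-after-short 2P≤n))) λ ()
    where
    summands : All (Summand us (suc j , suc n)) ((0 , 1) ∷ (1 , n) ∷ (j , 1) ∷ (suc j , n) ∷ [])
    summands = summand-e₂ v∈U ∷ summand-column₁ ∷ summand-flip summand-column₁
             ∷ summand-flip (summand-e₂ v∈U) ∷ []
    unique : Unique ((0 , 1) ∷ (1 , n) ∷ (j , 1) ∷ (suc j , n) ∷ [])
    unique = (≢₁ (λ ()) ∷ ≢₁ (<⇒≢ (<-trans z<s 2≤j)) ∷ ≢₁ (λ ()) ∷ [])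
           ∷ (≢₁ (<⇒≢ 2≤j) ∷ ≢₁ (<⇒≢ (s≤s (<-trans z<s 2≤j))) ∷ [])
           ∷ (≢₁ (<⇒≢ (n<1+n j)) ∷ [])
           ∷ [] ∷ []

  alternate-∈U : ∀ {n} → P + P ≤ n → (suc j , n) ∉U us → (suc j , suc n) ∈U us
  alternate-∈U {n} 2P≤n v∉U = #reps≡2⇒∈U (#reps-≡ ((≢₁ (<⇒≢ 2≤j) ∷ []) ∷ [] ∷ [])
                                                   (summand-column₁ ∷ summand-flip summand-column₁ ∷ [])
                                                   complete)
    where
    complete : ∀ {q} → Summand us (suc j , suc n) q → q ∈ (1 , n) ∷ (j , 1) ∷ []
    complete s@(summand w sums _ q∈U w∈U) with summands-after-short 2P≤n s
    ... | here refl =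
      contradiction (subst (_∈U us) (sym (+ᵥ⇒∸ᵥ sums)) w∈U) (∉U⇒¬∈U v∉U)
    ... | there (here q≡)                   = here q≡
    ... | there (there (here q≡))           = there (here q≡)
    ... | there (there (there (here refl))) = contradiction q∈U (∉U⇒¬∈U v∉U)

  element-above-2P : ∃ λ n₁ → P + P ≤ n₁ × (suc j , n₁) ∈U us
  element-above-2P with (suc j , P + P) ∈Uᵇ us Bool.≟ true
  ... | yes v∈U = P + P , ≤-refl , v∈U
  ... | no  v∉U = suc (P + P) , n≤1+n (P + P) , alternate-∈U ≤-refl (¬-not v∉U)

  module _ {n₁ : ℕ} (2P≤n₁ : P + P ≤ n₁) (start : (suc j , n₁) ∈U us) where

    every-second-∈U : ∀ k → (suc j , n₁ + k * 2) ∈U us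
    every-second-∈U zero    = subst (λ n → (suc j , n) ∈U us) (sym (+-identityʳ n₁)) start
    every-second-∈U (suc k) = subst (λ n → (suc j , n) ∈U us) (sym n₁+2+2k≡)
      (alternate-∈U (≤-trans 2P≤n (n≤1+n _)) (alternate-∉U 2P≤n (every-second-∈U k)))
      where
      2P≤n : P + P ≤ n₁ + k * 2
      2P≤n = ≤-trans 2P≤n₁ (m≤m+n n₁ (k * 2))
      n₁+2+2k≡ : n₁ + suc k * 2 ≡ suc (suc (n₁ + k * 2))
      n₁+2+2k≡ = trans (+-suc n₁ (suc (k * 2))) (cong suc (+-suc n₁ (k * 2)))

    row-parity-beyond : ∀ {m n} → suc j ≤ m → n₁ ≤ n → (m , n) ∈U us → n % 2 ≡ n₁ % 2
    row-parity-beyond {m} {n} 1+j≤m n₁≤n v∈U with even⊎odd (n ∸ n₁)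
    ... | k , inj₁ n-n₁≡2k =
      trans (cong (_% 2) (trans (sym (m+[n∸m]≡n n₁≤n)) (cong (n₁ +_) n-n₁≡2k))) ([m+kn]%n≡m%n n₁ k 2)
    ... | k , inj₂ n-n₁≡2k+1 =
      contradiction (subst (λ n → (m , n) ∈U us) n≡ v∈U)
        (∉U⇒¬∈U (next-row-∉U G (≤-trans 2≤j (n≤1+n j)) 1+j≤m 2≤n₁+2k (every-second-∈U k)
                             (above₂ (s≤s P≤n₁+2k))))
      where
      n≡ : n ≡ suc (n₁ + k * 2)
      n≡ = trans (sym (m+[n∸m]≡n n₁≤n)) (trans (cong (n₁ +_) n-n₁≡2k+1) (+-suc n₁ (k * 2)))
      P≤n₁+2k : P ≤ n₁ + k * 2
      P≤n₁+2k = ≤-trans (m≤m+n P P) (≤-trans 2P≤n₁ (m≤m+n n₁ (k * 2)))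
      2≤n₁+2k : 2 ≤ n₁ + k * 2
      2≤n₁+2k = ≤-trans 2≤P P≤n₁+2k

RowParityStable : List Vec2 → Set
RowParityStable us = ∃₂ λ w₁ w₂ → ∀ {m n} → w₁ ≤ m → w₂ ≤ n → (m , n) ∈U us → n % 2 ≡ w₂ % 2

row-parity-stable : ∀ {P us} → Generators P us → RowParityStable us
row-parity-stable {P} {us} G =
  let k , short , tall = first-failure (tall? G ∘ (2 +_)) (P + P) (some-column-short G)
      singleton = short-column-singleton G (s≤s (s≤s z≤n)) short (lows-before G tall ≤-refl)
      low : ∀ {i y} → 2 ≤ i → i < 2 + k → (i , y) ∈U us → y ≤ P
      low 2≤i i<2+k = subst (Low G) (m+[n∸m]≡n 2≤i) (lows-before G tall (∸-monoˡ-≤ 2 (<⇒≤ i<2+k)))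
      n₁ , 2P≤n₁ , start = element-above-2P G (s≤s (s≤s z≤n)) singleton low
  in 3 + k , n₁ , row-parity-beyond G (s≤s (s≤s z≤n)) singleton low 2P≤n₁ start

-- m₁ + c * 2 lies beyond both thresholds and has the parity of m₁ (similarly n₁ + r * 2).
both-parities-stable : ∀ {us} → RowParityStable us → RowParityStable (map swap us) →
  ∃₂ λ w₁ w₂ → ∀ m n → (m , n) ∈U us → w₁ ≤ m → w₂ ≤ n → (m % 2 ≡ w₁ % 2) × (n % 2 ≡ w₂ % 2)
both-parities-stable {us} (c , n₁ , rows) (r , m₁ , columns) =
  m₁ + c * 2 , n₁ + r * 2 , λ m n v∈U w₁≤m w₂≤n →
    trans (columns (≤-trans (m≤n+m*2 r n₁) w₂≤n) (≤-trans (m≤m+n m₁ _) w₁≤m)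
                   (trans (∈Uᵇ-swap us (m , n)) v∈U))
          (sym ([m+kn]%n≡m%n m₁ c 2)) ,
    trans (rows (≤-trans (m≤n+m*2 c m₁) w₁≤m) (≤-trans (m≤m+n n₁ _) w₂≤n) v∈U)
          (sym ([m+kn]%n≡m%n n₁ r 2))
  where
  m≤n+m*2 : ∀ m n → m ≤ n + m * 2
  m≤n+m*2 m n = ≤-trans (m≤m*n m 2) (m≤n+m (m * 2) n)

OffAxis : Vec2 → Set
OffAxis v = (proj₁ v ≢ 0) × (proj₂ v ≢ 0)

coordinate-bound : ∀ vs → ∃ λ B → All (_≤ᵥ (B , B)) vs
coordinate-bound []             = 0 , []
coordinate-bound ((a , b) ∷ vs) =
  let B , bounded = coordinate-bound vs
  in a + b + B , (≤-trans (m≤m+n a b) (m≤m+n (a + b) B) , ≤-trans (m≤n+m b a) (m≤m+n (a + b) B))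
               ∷ All.map (λ (x≤B , y≤B) → ≤-trans x≤B (m≤n+m B (a + b)) , ≤-trans y≤B (m≤n+m B (a + b)))
                         bounded

standard-generators : ∀ {vs} → All OffAxis vs → ∃ λ P → Generators P ((1 , 0) ∷ (0 , 1) ∷ vs)
standard-generators {vs} off-axis = 2 + B , record
  { 2≤P     = s≤s (s≤s z≤n)
  ; e₁∈     = here refl
  ; e₂∈     = there (here refl)
  ; axis₁   = axis₁′
  ; axis₂   = axis₂′
  ; bounded = bounded′
  }
  where
  B : ℕ
  B = proj₁ (coordinate-bound vs)
  axis₁′ : ∀ {m} → (m , 0) ∈ (1 , 0) ∷ (0 , 1) ∷ vs → m ≡ 1
  axis₁′ (here refl)           = refl
  axis₁′ (there (there m0∈vs)) = contradiction refl (proj₂ (All.lookup off-axis m0∈vs))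
  axis₂′ : ∀ {n} → (0 , n) ∈ (1 , 0) ∷ (0 , 1) ∷ vs → n ≡ 1
  axis₂′ (there (here refl))   = refl
  axis₂′ (there (there 0n∈vs)) = contradiction refl (proj₁ (All.lookup off-axis 0n∈vs))
  bounded′ : ∀ {v} → v ∈ (1 , 0) ∷ (0 , 1) ∷ vs → v ≤ᵥ (2 + B , 2 + B)
  bounded′ (here refl)          = s≤s z≤n , z≤n
  bounded′ (there (here refl))  = z≤n , s≤s z≤n
  bounded′ (there (there v∈vs)) =
    let x≤B , y≤B = All.lookup (proj₂ (coordinate-bound vs)) v∈vs
    in ≤-trans x≤B (m≤n+m B 2) , ≤-trans y≤B (m≤n+m B 2)

theorem6p1 : (vs : List Vec2) →
    All (λ v → (Data.Product.proj₁ v ≢ 0) × (Data.Product.proj₂ v ≢ 0)) vs →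
    NonDegenerate ((1 , 0) ∷ (0 , 1) ∷ vs) →
    ∃₂ λ (w₁ w₂ : ℕ) → (m n : ℕ) → (m , n) ∈U ((1 , 0) ∷ (0 , 1) ∷ vs) →
      w₁ ≤ m → w₂ ≤ n → (m % 2 ≡ w₁ % 2) × (n % 2 ≡ w₂ % 2)
theorem6p1 vs off-axis _ =
  let _ , G = standard-generators off-axis
  in both-parities-stable (row-parity-stable G) (row-parity-stable (swapᴳ G))
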